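{- Let $H>0$ and let $t$ be a tree with a basket node $x$ violating the Union condition, i.e. for some child $y$ of $x$, $\mathrm{sumsize}(t,x,\mathrm{size}(t,y)-1)<\mathrm{size}(t,y)-1$. Let $z,w$ be distinct sibling light nodes of $t$ with $\mathrm{size}(t,z)+\mathrm{size}(t,w)\le H$, and let $t'=\mathrm{push}(t,z,w)$. Then $x$ still violates the Union condition in $t'$.
   Context: A tree is $t=(V_t,\mathrm{root}_t,\mathrm{parent}_t)$ with finite node set, a root, and a parent map on non-root nodes such that iterating it from any node reaches the root. $\mathrm{children}(t,x)$ is the set of children of $x$; $\mathrm{size}(t,x)$ is the number of descendants of $x$ including $x$. For $W\ge0$, $\mathrm{sumsize}(t,x,W)=\sum\{\mathrm{size}(t,y): y\in\mathrm{children}(t,x),\ \mathrm{size}(t,y)\le W\}$. A node $x$ satisfies the Union condition if for every child $y$ of $x$, $\mathrm{sumsize}(t,x,\mathrm{size}(t,y)-1)\ge \mathrm{size}(t,y)-1$; otherwise it violates it. For distinct siblings $z\ne w$ in $t$, $\mathrm{push}(t,z,w)$ has the same nodes and root, with the parent of $z$ changed to $w$, other parents unchanged. A node is light if its size is $\le H$, heavy if $>H$, and a basket if it has a heavy child. -}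

module Defs where

open import Data.Nat using (ℕ; zero; suc; _+_; _∸_; _≤_; _<_; _≤?_)
open import Data.Fin using (Fin; _≟_)
open import Data.Bool using (Bool; true; false; if_then_else_; not; _∧_)
open import Data.List using (List; map; upTo; allFin)
open import Data.Nat.ListAction using (sum)
open import Data.Bool.ListAction using (any)
open import Data.Product using (Σ; ∃; _×_)
open import Relation.Nullary using (¬_)
open import Relation.Nullary.Decidable using (⌊_⌋)
open import Relation.Binary.PropositionalEquality using (_≡_; _≢_)

-- A (raw) rooted structure on the node set Fin n: a root and a parent map.
-- The value `parent root` is irrelevant: it is never used (see `step`, `Child`).
record RawTree (n : ℕ) : Set where
  field
    root   : Fin n
    parent : Fin n → Fin n
open RawTree public

module _ {n : ℕ} (t : RawTree n) where

  step : Fin n → Fin n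
  step y = if ⌊ y ≟ root t ⌋ then root t else parent t y

  iter : ℕ → Fin n → Fin n
  iter zero    y = y
  iter (suc k) y = step (iter k y)

  IsTree : Set
  IsTree = ∀ (x : Fin n) → ∃ λ k → iter k x ≡ root t

  -- y is a descendant of x (including x itself); paths in a tree on n nodes
  -- have length < n, so checking k ≤ n suffices
  isDesc : Fin n → Fin n → Bool
  isDesc x y = any (λ k → ⌊ iter k y ≟ x ⌋) (upTo (suc n))

  size : Fin n → ℕ
  size x = sum (map (λ y → if isDesc x y then 1 else 0) (allFin n))

  Child : Fin n → Fin n → Set
  Child x y = (y ≢ root t) × (parent t y ≡ x)

  isChild : Fin n → Fin n → Bool
  isChild x y = not ⌊ y ≟ root t ⌋ ∧ ⌊ parent t y ≟ x ⌋

  sumsize : Fin n → ℕ → ℕ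
  sumsize x W = sum (map (λ y → if isChild x y ∧ ⌊ size y ≤? W ⌋ then size y else 0) (allFin n))

  ViolatesUnion : Fin n → Set
  ViolatesUnion x = ∃ λ y → Child x y × (sumsize x (size y ∸ 1) < size y ∸ 1)

  Light : ℕ → Fin n → Set
  Light H x = size x ≤ H

  Heavy : ℕ → Fin n → Set
  Heavy H x = H < size x

  Basket : ℕ → Fin n → Set
  Basket H x = ∃ λ y → Child x y × Heavy H y

  DistinctSiblings : Fin n → Fin n → Set
  DistinctSiblings z w =
    (z ≢ w) × (z ≢ root t) × (w ≢ root t) × (parent t z ≡ parent t w)

push : ∀ {n} → RawTree n → Fin n → Fin n → RawTree n
push t z w = record
  { root   = root t
  ; parent = λ v → if ⌊ v ≟ z ⌋ then w else parent t v
  }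

module Submission where

-- Pushing z under its sibling w changes the parent map at z only.  Hence the
-- descendant set of every node other than z and w is unchanged, the new
-- subtree of w is the disjoint union of the old subtrees of w and z, and z
-- stops being a child of x (x ≠ w, since w is light while x has a heavy
-- child).  So for every bound W, sumsize(x,W) does not increase: the new
-- contribution of w is at most the old contributions of w and z together.
-- The old violation at a child y of size m thus gives sumsize'(x,m-1) < m-1.
-- A general descent lemma turns such a gap, together with any child of size
-- at least m, into a violated child: if a child c of size ≥ m is not violated,
-- then sumsize'(x, size c - 1) ≥ size c - 1 > sumsize'(x, m-1), so some child
-- has size in [m, size c), and we recurse.  The child of size ≥ m is y itself
-- when y ∉ {z, w}, and the heavy child of x otherwise.

open import Defs
open import Data.Nat using (ℕ; zero; suc; _+_; _∸_; _≤_; _<_; z≤n; s≤s; _≤?_; _<?_)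
open import Data.Nat.Properties
  using (≤-refl; ≤-trans; ≤-reflexive; ≤-antisym; ≤-pred; <⇒≤; <-≤-trans; ≤-<-trans; <-irrefl;
         <⇒≱; ≮⇒≥; ≰⇒>; +-mono-≤; +-monoˡ-≤; +-monoʳ-<; +-identityʳ; +-cancelʳ-≤;
         m≤m+n; m≤n+m; ∸-monoˡ-≤; m∸n+n≡m; n<1+n; +-commutativeSemigroup; module ≤-Reasoning)
open import Data.Nat.Induction using (<-rec)
open import Algebra.Properties.CommutativeSemigroup +-commutativeSemigroup using (interchange)
open import Data.Fin using (Fin; toℕ; _≟_) renaming (zero to fzero; suc to fsuc)
open import Data.Fin.Properties using (pigeonhole; toℕ<n; suc-injective)
open import Data.Bool using (Bool; true; false; T; if_then_else_; _∧_)
open import Data.Unit using (tt)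
open import Data.List using (List; []; _∷_; map; upTo; allFin; tabulate)
open import Data.List.Properties using (map-cong; map-tabulate)
open import Data.List.Relation.Unary.Any using (satisfied)
open import Data.List.Relation.Unary.Any.Properties using (any⁺; any⁻)
open import Data.List.Membership.Propositional using (lose)
open import Data.List.Membership.Propositional.Properties using (∈-upTo⁺)
open import Data.Nat.ListAction using (sum)
open import Data.Product using (∃; _×_; _,_; proj₁; proj₂)
open import Data.Sum using (_⊎_; inj₁; inj₂) renaming (map to ⊎-map)
open import Data.Empty using (⊥; ⊥-elim)
open import Function using (_∘_)
open import Relation.Nullary using (¬_; Dec; yes; no)
open import Relation.Nullary.Decidable using (⌊_⌋; toWitness; fromWitness; map′; T?)
open import Relation.Binary.PropositionalEquality
  using (_≡_; _≢_; refl; sym; trans; cong; cong₂; subst; module ≡-Reasoning)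

module _ {A : Set} where

  sum-map-mono : ∀ (f g : A → ℕ) (l : List A) → (∀ v → f v ≤ g v) →
                 sum (map f l) ≤ sum (map g l)
  sum-map-mono f g []      f≤g = z≤n
  sum-map-mono f g (v ∷ l) f≤g = +-mono-≤ (f≤g v) (sum-map-mono f g l f≤g)

  sum-map-+ : ∀ (f g : A → ℕ) (l : List A) →
              sum (map (λ v → f v + g v) l) ≡ sum (map f l) + sum (map g l)
  sum-map-+ f g []      = refl
  sum-map-+ f g (v ∷ l) = begin
    f v + g v + sum (map (λ u → f u + g u) l)     ≡⟨ cong (f v + g v +_) (sum-map-+ f g l) ⟩
    f v + g v + (sum (map f l) + sum (map g l))   ≡⟨ interchange (f v) (g v) _ _ ⟩
    f v + sum (map f l) + (g v + sum (map g l))   ∎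
    where open ≡-Reasoning

  sum-map-< : ∀ (f g : A → ℕ) (l : List A) → sum (map f l) < sum (map g l) →
              ∃ λ v → f v < g v
  sum-map-< f g (v ∷ l) lt with f v <? g v
  ... | yes fv<gv = v , fv<gv
  ... | no  fv≮gv with sum (map f l) <? sum (map g l)
  ... | yes rest<  = sum-map-< f g l rest<
  ... | no  rest≮  = ⊥-elim (<⇒≱ lt (+-mono-≤ (≮⇒≥ fv≮gv) (≮⇒≥ rest≮)))

sum-tabulate-single : ∀ {n} (h : Fin n → ℕ) (a : Fin n) → (∀ v → v ≢ a → h v ≡ 0) →
                      sum (tabulate h) ≡ h a
sum-tabulate-single h fzero    off = begin
  h fzero + sum (tabulate (h ∘ fsuc))
    ≡⟨ cong (h fzero +_) (sum-zero (h ∘ fsuc) λ v → off (fsuc v) λ ()) ⟩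
  h fzero + 0
    ≡⟨ +-identityʳ (h fzero) ⟩
  h fzero ∎
  where
  open ≡-Reasoning
  sum-zero : ∀ {m} (k : Fin m → ℕ) → (∀ v → k v ≡ 0) → sum (tabulate k) ≡ 0
  sum-zero {zero}  k k≡0 = refl
  sum-zero {suc m} k k≡0 = cong₂ _+_ (k≡0 fzero) (sum-zero (k ∘ fsuc) (k≡0 ∘ fsuc))
sum-tabulate-single h (fsuc a) off =
  cong₂ _+_ (off fzero λ ())
            (sum-tabulate-single (h ∘ fsuc) a (λ v v≢a → off (fsuc v) (v≢a ∘ suc-injective)))

module _ {n : ℕ} where

  point : Fin n → ℕ → Fin n → ℕ
  point a c v = if ⌊ v ≟ a ⌋ then c else 0

  sum-point : ∀ a c → sum (map (point a c) (allFin n)) ≡ c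
  sum-point a c = trans (cong sum (map-tabulate (λ v → v) (point a c)))
                        (trans (sum-tabulate-single (point a c) a off) at-a)
    where
    off : ∀ v → v ≢ a → point a c v ≡ 0
    off v v≢a with v ≟ a
    ... | yes v≡a = ⊥-elim (v≢a v≡a)
    ... | no  _   = refl
    at-a : point a c a ≡ c
    at-a with a ≟ a
    ... | yes _   = refl
    ... | no  a≢a = ⊥-elim (a≢a refl)

  sum-merge-≤ : ∀ (f g : Fin n → ℕ) (z w : Fin n) → z ≢ w →
                f z ≡ 0 → f w ≤ g w + g z → (∀ v → v ≢ z → v ≢ w → f v ≤ g v) →
                sum (map f (allFin n)) ≤ sum (map g (allFin n))
  sum-merge-≤ f g z w z≢w fz≡0 fw≤ rest = +-cancelʳ-≤ (g z) _ _ (begin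
    sum (map f (allFin n)) + g z
      ≡⟨ cong (sum (map f (allFin n)) +_) (sym (sum-point z (g z))) ⟩
    sum (map f (allFin n)) + sum (map (point z (g z)) (allFin n))
      ≡⟨ sym (sum-map-+ f (point z (g z)) (allFin n)) ⟩
    sum (map (λ v → f v + point z (g z) v) (allFin n))
      ≤⟨ sum-map-mono _ _ (allFin n) pointwise ⟩
    sum (map (λ v → g v + point w (g z) v) (allFin n))
      ≡⟨ sum-map-+ g (point w (g z)) (allFin n) ⟩
    sum (map g (allFin n)) + sum (map (point w (g z)) (allFin n))
      ≡⟨ cong (sum (map g (allFin n)) +_) (sum-point w (g z)) ⟩
    sum (map g (allFin n)) + g z ∎)
    where
    open ≤-Reasoning
    pointwise : ∀ v → f v + point z (g z) v ≤ g v + point w (g z) v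
    pointwise v with v ≟ z | v ≟ w
    ... | yes refl | yes v≡w = ⊥-elim (z≢w v≡w)
    ... | yes refl | no  _   = ≤-reflexive (trans (cong (_+ g z) fz≡0) (sym (+-identityʳ (g z))))
    ... | no  _    | yes refl = ≤-trans (≤-reflexive (+-identityʳ (f w))) fw≤
    ... | no  v≢z  | no  v≢w = +-monoˡ-≤ 0 (rest v v≢z v≢w)

data Anc {n : ℕ} (t : RawTree n) (d : Fin n) : Fin n → Set where
  here : Anc t d d
  up   : ∀ {v} → Anc t d (step t v) → Anc t d v

module Ancestry {n : ℕ} (t : RawTree n) where

  anc-trans : ∀ {a b c} → Anc t a b → Anc t b c → Anc t a c
  anc-trans ab here   = ab
  anc-trans ab (up r) = up (anc-trans ab r)

  anc-step : ∀ {v} → Anc t (step t v) v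
  anc-step = up here

  anc-step-inv : ∀ {d v} → Anc t d v → v ≢ d → Anc t d (step t v)
  anc-step-inv here   v≢d = ⊥-elim (v≢d refl)
  anc-step-inv (up r) _   = r

  anc-comparable : ∀ {a b v} → Anc t a v → Anc t b v → Anc t a b ⊎ Anc t b a
  anc-comparable here   s      = inj₂ s
  anc-comparable (up r) here   = inj₁ (up r)
  anc-comparable (up r) (up s) = anc-comparable r s

  step-root : step t (root t) ≡ root t
  step-root with root t ≟ root t
  ... | yes _   = refl
  ... | no  r≢r = ⊥-elim (r≢r refl)

  step-nonroot : ∀ {v} → v ≢ root t → step t v ≡ parent t v
  step-nonroot {v} v≢r with v ≟ root t
  ... | yes v≡r = ⊥-elim (v≢r v≡r)
  ... | no  _   = refl

  child-anc : ∀ {x y} → Child t x y → Anc t x y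
  child-anc (y≢r , py≡x) = up (subst (Anc t _) (sym (trans (step-nonroot y≢r) py≡x)) here)

  anc-fixed : ∀ {d u v} → step t u ≡ u → Anc t d v → v ≡ u → d ≡ u
  anc-fixed su here   v≡u = v≡u
  anc-fixed su (up r) v≡u = anc-fixed su r (trans (cong (step t) v≡u) su)

  anc-antisym : ∀ {a b} → Anc t (root t) a → Anc t a b → Anc t b a → a ≡ b
  anc-antisym here ab ba = sym (anc-fixed step-root ba refl)
  anc-antisym {a} {b} (up r) ab ba with a ≟ b
  ... | yes a≡b = a≡b
  ... | no  a≢b = trans (sym step-a≡a) step-a≡b
    where
    step-a≡b : step t a ≡ b
    step-a≡b = anc-antisym r (anc-trans anc-step ab) (anc-step-inv ba a≢b)
    step-a≡a : step t a ≡ a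
    step-a≡a = anc-antisym r anc-step (subst (Anc t a) (sym step-a≡b) ab)

  iter-step : ∀ k v → iter t k (step t v) ≡ step t (iter t k v)
  iter-step zero    v = refl
  iter-step (suc k) v = cong (step t) (iter-step k v)

  iter-+ : ∀ m k v → iter t (m + k) v ≡ iter t m (iter t k v)
  iter-+ zero    k v = refl
  iter-+ (suc m) k v = cong (step t) (iter-+ m k v)

  iter→anc : ∀ k {v d} → iter t k v ≡ d → Anc t d v
  iter→anc zero    refl = here
  iter→anc (suc k) {v} e = up (iter→anc k (trans (iter-step k v) e))

  anc→iter : ∀ {d v} → Anc t d v → ∃ λ k → iter t k v ≡ d
  anc→iter here = 0 , refl
  anc→iter {v = v} (up r) with anc→iter r
  ... | k , e = suc k , trans (sym (iter-step k v)) e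

  -- Every ancestor is reached within n steps: among the first n+1 iterates two
  -- coincide (pigeonhole), and cutting out the loop between them shortens the path.
  short-path : ∀ k {v d} → iter t k v ≡ d → ∃ λ k′ → k′ ≤ n × iter t k′ v ≡ d
  short-path = <-rec Shortenable shorten
    where
    Shortenable : ℕ → Set
    Shortenable k = ∀ {v d} → iter t k v ≡ d → ∃ λ k′ → k′ ≤ n × iter t k′ v ≡ d
    shorten : ∀ k → (∀ {k′} → k′ < k → Shortenable k′) → Shortenable k
    shorten k rec {v} e with k ≤? n
    ... | yes k≤n = k , k≤n , e
    ... | no  k≰n with pigeonhole (n<1+n n) (λ i → iter t (toℕ i) v)
    ... | i , j , i<j , loop = rec k′<k e′
      where
      j≤k : toℕ j ≤ k
      j≤k = ≤-trans (≤-pred (toℕ<n j)) (<⇒≤ (≰⇒> k≰n))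
      rest : k ∸ toℕ j + toℕ j ≡ k
      rest = m∸n+n≡m j≤k
      k′ : ℕ
      k′ = k ∸ toℕ j + toℕ i
      k′<k : k′ < k
      k′<k = subst (k′ <_) rest (+-monoʳ-< (k ∸ toℕ j) i<j)
      e′ : iter t k′ v ≡ _
      e′ = begin
        iter t (k ∸ toℕ j + toℕ i) v        ≡⟨ iter-+ (k ∸ toℕ j) (toℕ i) v ⟩
        iter t (k ∸ toℕ j) (iter t (toℕ i) v) ≡⟨ cong (iter t (k ∸ toℕ j)) loop ⟩
        iter t (k ∸ toℕ j) (iter t (toℕ j) v) ≡⟨ sym (iter-+ (k ∸ toℕ j) (toℕ j) v) ⟩
        iter t (k ∸ toℕ j + toℕ j) v        ≡⟨ cong (λ q → iter t q v) rest ⟩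
        iter t k v                          ≡⟨ e ⟩
        _                                   ∎
        where open ≡-Reasoning

  isDesc→anc : ∀ {d v} → T (isDesc t d v) → Anc t d v
  isDesc→anc {d} {v} h with satisfied (any⁻ _ (upTo (suc n)) h)
  ... | k , e = iter→anc k (toWitness e)

  -- isDesc only tries paths of length ≤ n, which suffices by short-path
  anc→isDesc : ∀ {d v} → Anc t d v → T (isDesc t d v)
  anc→isDesc r with anc→iter r
  ... | k , e with short-path k e
  ... | k′ , k′≤n , e′ = any⁺ _ (lose (∈-upTo⁺ (s≤s k′≤n)) (fromWitness e′))

  anc? : ∀ d v → Dec (Anc t d v)
  anc? d v = map′ isDesc→anc anc→isDesc (T? (isDesc t d v))

  sibling-ancestor : ∀ {a b c} → step t a ≡ step t b → c ≢ a → Anc t c a → Anc t c b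
  sibling-ancestor same c≢a ca = up (subst (Anc t _) same (anc-step-inv ca (c≢a ∘ sym)))

  Rooted : Set
  Rooted = ∀ v → Anc t (root t) v

  isTree→rooted : IsTree t → Rooted
  isTree→rooted tree v = iter→anc (proj₁ (tree v)) (proj₂ (tree v))

  siblings-incomparable : Rooted → ∀ {a b} → a ≢ b → a ≢ root t → step t a ≡ step t b →
                          ¬ Anc t a b
  siblings-incomparable rooted {a} {b} a≢b a≢r same ab = a≢r (sym root≡a)
    where
    a-above-step : Anc t a (step t a)
    a-above-step = subst (Anc t a) (sym same) (anc-step-inv ab (a≢b ∘ sym))
    a≡step-a : a ≡ step t a
    a≡step-a = anc-antisym (rooted a) a-above-step anc-step
    root≡a : root t ≡ a
    root≡a = anc-fixed (sym a≡step-a) (rooted a) refl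

indicator : Bool → ℕ
indicator b = if b then 1 else 0

indicator-mono : ∀ {a b} → (T a → T b) → indicator a ≤ indicator b
indicator-mono {false}        _   = z≤n
indicator-mono {true} {true}  _   = ≤-refl
indicator-mono {true} {false} a→b = ⊥-elim (a→b tt)

indicator-disjoint-union : ∀ {c a b} → (T c → T a ⊎ T b) → (T a → T c) → (T b → T c) →
                           (T a → T b → ⊥) → indicator c ≡ indicator a + indicator b
indicator-disjoint-union {true}  {true}  {true}  _   _   _   disj = ⊥-elim (disj tt tt)
indicator-disjoint-union {true}  {true}  {false} _   _   _   _    = refl
indicator-disjoint-union {true}  {false} {true}  _   _   _   _    = refl
indicator-disjoint-union {true}  {false} {false} c→  _   _   _    with c→ tt
... | inj₁ ()
... | inj₂ ()
indicator-disjoint-union {false} {true}  {_}     _   a→c _   _    = ⊥-elim (a→c tt)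
indicator-disjoint-union {false} {false} {true}  _   _   b→c _    = ⊥-elim (b→c tt)
indicator-disjoint-union {false} {false} {false} _   _   _   _    = refl

module _ {n : ℕ} where
  open Ancestry

  size-mono : ∀ {s t : RawTree n} {d e} → (∀ {v} → Anc s d v → Anc t e v) →
              size s d ≤ size t e
  size-mono {s} {t} {d} {e} sub =
    sum-map-mono (λ v → indicator (isDesc s d v)) (λ v → indicator (isDesc t e v)) (allFin n)
                 (λ v → indicator-mono (anc→isDesc t ∘ sub ∘ isDesc→anc s))

  size-cong : ∀ {s t : RawTree n} {d e} → (∀ {v} → Anc s d v → Anc t e v) →
              (∀ {v} → Anc t e v → Anc s d v) → size s d ≡ size t e
  size-cong to from = ≤-antisym (size-mono to) (size-mono from)

  size-disjoint-union : ∀ {s t : RawTree n} {d a b} →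
                        (∀ {v} → Anc s d v → Anc t a v ⊎ Anc t b v) →
                        (∀ {v} → Anc t a v → Anc s d v) → (∀ {v} → Anc t b v → Anc s d v) →
                        (∀ {v} → Anc t a v → Anc t b v → ⊥) →
                        size s d ≡ size t a + size t b
  size-disjoint-union {s} {t} {d} {a} {b} split from-a from-b disj = trans
    (cong sum (map-cong pointwise (allFin n)))
    (sum-map-+ (λ v → indicator (isDesc t a v)) (λ v → indicator (isDesc t b v)) (allFin n))
    where
    pointwise : ∀ v → indicator (isDesc s d v) ≡
                      indicator (isDesc t a v) + indicator (isDesc t b v)
    pointwise v = indicator-disjoint-union
      (λ dv → ⊎-map (anc→isDesc t) (anc→isDesc t) (split (isDesc→anc s dv)))
      (anc→isDesc s ∘ from-a ∘ isDesc→anc t) (anc→isDesc s ∘ from-b ∘ isDesc→anc t)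
      (λ av bv → disj (isDesc→anc t av) (isDesc→anc t bv))

child-size-≤ : ∀ {n} (t : RawTree n) {x y} → Child t x y → size t y ≤ size t x
child-size-≤ t y-child = size-mono (Ancestry.anc-trans t (Ancestry.child-anc t y-child))

module _ {n : ℕ} (t : RawTree n) where

  isChild→child : ∀ {x y} → T (isChild t x y) → Child t x y
  isChild→child {x} {y} h with y ≟ root t | parent t y ≟ x
  ... | no y≢r | yes py≡x = y≢r , py≡x

  child→isChild : ∀ {x y} → Child t x y → T (isChild t x y)
  child→isChild {x} {y} (y≢r , py≡x) with y ≟ root t | parent t y ≟ x
  ... | yes y≡r | _        = ⊥-elim (y≢r y≡r)
  ... | no  _   | no py≢x  = ⊥-elim (py≢x py≡x)
  ... | no  _   | yes _    = tt

contribution : Bool → ℕ → ℕ → ℕ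
contribution c s W = if c ∧ ⌊ s ≤? W ⌋ then s else 0

contribution-gap : ∀ c s W₁ W₂ → contribution c s W₁ < contribution c s W₂ →
                   T c × W₁ < s × s ≤ W₂
contribution-gap true s W₁ W₂ lt with s ≤? W₁ | s ≤? W₂
... | yes _    | yes _    = ⊥-elim (<-irrefl refl lt)
... | yes _    | no  _    = ⊥-elim (<⇒≱ lt z≤n)
... | no  _    | no  _    = ⊥-elim (<-irrefl refl lt)
... | no  s≰W₁ | yes s≤W₂ = tt , ≰⇒> s≰W₁ , s≤W₂

contribution-merge : ∀ c c′ a b W → (T c → T c′) →
                     contribution c (a + b) W ≤ contribution c a W + contribution c′ b W
contribution-merge false c′ a b W _ = z≤n
contribution-merge true  c′ a b W c→c′ with c′ | c→c′ tt
... | true | _ with a + b ≤? W | a ≤? W | b ≤? W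
...   | no  _     | _      | _      = z≤n
...   | yes _     | yes _  | yes _  = ≤-refl
...   | yes a+b≤W | no a≰W | _      = ⊥-elim (a≰W (≤-trans (m≤m+n a b) a+b≤W))
...   | yes a+b≤W | yes _  | no b≰W = ⊥-elim (b≰W (≤-trans (m≤n+m b a) a+b≤W))

sumsize-gap : ∀ {n} (t : RawTree n) (x : Fin n) (W₁ W₂ : ℕ) →
              sumsize t x W₁ < sumsize t x W₂ →
              ∃ λ v → Child t x v × W₁ < size t v × size t v ≤ W₂
sumsize-gap {n} t x W₁ W₂ lt
  with sum-map-< (λ v → contribution (isChild t x v) (size t v) W₁)
                 (λ v → contribution (isChild t x v) (size t v) W₂) (allFin n) lt
... | v , v< with contribution-gap (isChild t x v) (size t v) W₁ W₂ v<
... | child , W₁<v , v≤W₂ = v , isChild→child t child , W₁<v , v≤W₂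

∸1<⇒≤ : ∀ {m s} → m ∸ 1 < s → m ≤ s
∸1<⇒≤ {zero}  _ = z≤n
∸1<⇒≤ {suc m} p = p

≤∸1⇒< : ∀ {s c} → 0 < s → s ≤ c ∸ 1 → s < c
≤∸1⇒< {c = zero}  0<s s≤0 = ⊥-elim (<⇒≱ 0<s s≤0)
≤∸1⇒< {c = suc c} _   s≤c = s≤s s≤c

-- A non-violated child c of size ≥ m has
-- sumsize x (size c - 1) ≥ size c - 1 > sumsize x (m-1), so by sumsize-gap
-- a child of size in [m, size c) exists; recurse on the size.
violation-from-gap : ∀ {n} (t : RawTree n) (x : Fin n) (m : ℕ) →
                     sumsize t x (m ∸ 1) < m ∸ 1 →
                     (∃ λ c → Child t x c × m ≤ size t c) → ViolatesUnion t x
violation-from-gap t x m gap (c , c-child , m≤c) =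
  <-rec LargeChild descend (size t c) c refl c-child m≤c
  where
  LargeChild : ℕ → Set
  LargeChild k = ∀ c → size t c ≡ k → Child t x c → m ≤ size t c → ViolatesUnion t x
  descend : ∀ k → (∀ {k′} → k′ < k → LargeChild k′) → LargeChild k
  descend _ rec c refl c-child m≤c with sumsize t x (size t c ∸ 1) <? size t c ∸ 1
  ... | yes c-violates = c , c-child , c-violates
  ... | no  c-fine with sumsize-gap t x (m ∸ 1) (size t c ∸ 1)
                          (<-≤-trans gap (≤-trans (∸-monoˡ-≤ 1 m≤c) (≮⇒≥ c-fine)))
  ... | v , v-child , m-1<v , v≤c-1 =
    rec (≤∸1⇒< (≤-<-trans z≤n m-1<v) v≤c-1) v refl v-child (∸1<⇒≤ m-1<v)

module Transfer {n : ℕ} (t₁ t₂ : RawTree n) (z : Fin n)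
                (agree : ∀ {v} → v ≢ z → step t₁ v ≡ step t₂ v) where

  transfer : ∀ {d v} → Anc t₁ d v → (∀ {u} → Anc t₁ u v → Anc t₁ d u → u ≡ z → u ≡ d) →
             Anc t₂ d v
  transfer here _ = here
  transfer {d} {v} (up r) meets-z-at-end with v ≟ z
  ... | yes v≡z = subst (Anc t₂ d) (sym (meets-z-at-end here (up r) v≡z)) here
  ... | no  v≢z = up (subst (Anc t₂ d) (agree v≢z) (transfer r (meets-z-at-end ∘ up)))

  transfer-avoiding : ∀ {d v} → Anc t₁ d v → ¬ Anc t₁ z v → Anc t₂ d v
  transfer-avoiding r z∤v =
    transfer r λ uv _ u≡z → ⊥-elim (z∤v (subst (λ u → Anc t₁ u _) u≡z uv))

  transfer-to-z : ∀ {v} → Anc t₁ z v → Anc t₂ z v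
  transfer-to-z r = transfer r λ _ _ u≡z → u≡z

  -- paths ending inside the subtree of z (z cannot lie strictly between)
  transfer-below-z : Ancestry.Rooted t₁ → ∀ {d v} → Anc t₁ d v → Anc t₁ z d → Anc t₂ d v
  transfer-below-z rooted r z-above-d = transfer r λ {u} _ du u≡z →
    trans u≡z (Ancestry.anc-antisym t₁ (rooted z) z-above-d (subst (Anc t₁ _) u≡z du))

module Push {n : ℕ} (t : RawTree n) (rooted : Ancestry.Rooted t) (z w : Fin n)
            (z≢w : z ≢ w) (z≢r : z ≢ root t) (w≢r : w ≢ root t)
            (pz≡pw : parent t z ≡ parent t w) where

  t′ : RawTree n
  t′ = push t z w

  private
    module O = Ancestry t
    module N = Ancestry t′

  step-agree : ∀ {v} → v ≢ z → step t v ≡ step t′ v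
  step-agree {v} v≢z with v ≟ root t | v ≟ z
  ... | yes _ | _       = refl
  ... | no  _ | yes v≡z = ⊥-elim (v≢z v≡z)
  ... | no  _ | no  _   = refl

  step-z : step t′ z ≡ w
  step-z with z ≟ root t | z ≟ z
  ... | yes z≡r | _       = ⊥-elim (z≢r z≡r)
  ... | no  _   | yes _   = refl
  ... | no  _   | no  z≢z = ⊥-elim (z≢z refl)

  private
    module Forth = Transfer t t′ z step-agree
    module Back  = Transfer t′ t z (sym ∘ step-agree)

  step-w≡step-z : step t w ≡ step t z
  step-w≡step-z = trans (O.step-nonroot w≢r) (trans (sym pz≡pw) (sym (O.step-nonroot z≢r)))

  z∤w : ¬ Anc t z w
  z∤w = O.siblings-incomparable rooted z≢w z≢r (sym step-w≡step-z)

  w∤z : ¬ Anc t w z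
  w∤z = O.siblings-incomparable rooted (z≢w ∘ sym) w≢r step-w≡step-z

  w-above-z : Anc t′ w z
  w-above-z = up (subst (Anc t′ w) (sym step-z) here)

  via-w : ∀ {c v} → Anc t c w → Anc t z v → Anc t′ c v
  via-w cw zv = N.anc-trans (N.anc-trans (Forth.transfer-avoiding cw z∤w) w-above-z)
                            (Forth.transfer-to-z zv)

  rooted′ : N.Rooted
  rooted′ v with O.anc? z v
  ... | no  z∤v = Forth.transfer-avoiding (rooted v) z∤v
  ... | yes z∣v = via-w (rooted w) z∣v

  z∤′w : ¬ Anc t′ z w
  z∤′w zw = z≢w (N.anc-antisym (rooted′ z) zw w-above-z)

  anc-other→ : ∀ {c v} → c ≢ z → c ≢ w → Anc t c v → Anc t′ c v
  anc-other→ {c} {v} c≢z c≢w cv with O.anc? z v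
  ... | no  z∤v = Forth.transfer-avoiding cv z∤v
  ... | yes z∣v with O.anc-comparable cv z∣v
  ...   | inj₁ cz = via-w (O.sibling-ancestor (sym step-w≡step-z) c≢z cz) z∣v
  ...   | inj₂ zc = Forth.transfer-below-z rooted cv zc

  anc-other← : ∀ {c v} → c ≢ z → c ≢ w → Anc t′ c v → Anc t c v
  anc-other← {c} {v} c≢z c≢w cv with N.anc? z v
  ... | no  z∤v = Back.transfer-avoiding cv z∤v
  ... | yes z∣v with N.anc-comparable cv z∣v
  ...   | inj₁ cz = O.anc-trans (O.sibling-ancestor step-w≡step-z c≢w cw) (Back.transfer-to-z z∣v)
    where
    cw : Anc t c w
    cw = Back.transfer-avoiding (subst (Anc t′ c) step-z (N.anc-step-inv cz (c≢z ∘ sym))) z∤′w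
  ...   | inj₂ zc = Back.transfer-below-z rooted′ cv zc

  anc-w→ : ∀ {v} → Anc t′ w v → Anc t w v ⊎ Anc t z v
  anc-w→ {v} wv with N.anc? z v
  ... | no  z∤v = inj₁ (Back.transfer-avoiding wv z∤v)
  ... | yes z∣v = inj₂ (Back.transfer-to-z z∣v)

  anc-w← : ∀ {v} → Anc t w v → Anc t′ w v
  anc-w← {v} wv with O.anc? z v
  ... | no  z∤v = Forth.transfer-avoiding wv z∤v
  ... | yes z∣v = via-w here z∣v

  w-z-disjoint : ∀ {v} → Anc t w v → Anc t z v → ⊥
  w-z-disjoint wv zv with O.anc-comparable wv zv
  ... | inj₁ wz = w∤z wz
  ... | inj₂ zw = z∤w zw

  size-other : ∀ {c} → c ≢ z → c ≢ w → size t′ c ≡ size t c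
  size-other c≢z c≢w = size-cong (anc-other← c≢z c≢w) (anc-other→ c≢z c≢w)

  size-w : size t′ w ≡ size t w + size t z
  size-w = size-disjoint-union anc-w→ anc-w← (via-w here) w-z-disjoint

  isChild-other : ∀ {x v} → v ≢ z → isChild t′ x v ≡ isChild t x v
  isChild-other {x} {v} v≢z with v ≟ z
  ... | yes v≡z = ⊥-elim (v≢z v≡z)
  ... | no  _   = refl

  isChild-z : ∀ {x} → x ≢ w → isChild t′ x z ≡ false
  isChild-z {x} x≢w with z ≟ root t | z ≟ z
  ... | yes _ | _       = refl
  ... | no  _ | no  z≢z = ⊥-elim (z≢z refl)
  ... | no  _ | yes _ with w ≟ x
  ...   | yes w≡x = ⊥-elim (x≢w (sym w≡x))
  ...   | no  _   = refl

  child-kept : ∀ {x c} → c ≢ z → Child t x c → Child t′ x c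
  child-kept c≢z c-child =
    isChild→child t′ (subst T (sym (isChild-other c≢z)) (child→isChild t c-child))

  -- unless x = w, no bound W lets sumsize at x grow: z leaves x, and w's new
  -- contribution is bounded by the old ones of w and z (a sibling of z)
  sumsize-≤ : ∀ {x} → x ≢ w → ∀ W → sumsize t′ x W ≤ sumsize t x W
  sumsize-≤ {x} x≢w W = sum-merge-≤ new old z w z≢w new-z new-w new-other
    where
    new old : Fin n → ℕ
    new v = contribution (isChild t′ x v) (size t′ v) W
    old v = contribution (isChild t x v) (size t v) W
    new-z : new z ≡ 0
    new-z = cong (λ c → contribution c (size t′ z) W) (isChild-z x≢w)
    w-child→z-child : T (isChild t x w) → T (isChild t x z)
    w-child→z-child h = child→isChild t (z≢r , trans pz≡pw (proj₂ (isChild→child t h)))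
    new-w : new w ≤ old w + old z
    new-w = begin
      new w                                                 ≡⟨ cong₂ (λ c s → contribution c s W)
                                                                 (isChild-other (z≢w ∘ sym)) size-w ⟩
      contribution (isChild t x w) (size t w + size t z) W  ≤⟨ contribution-merge _ _ _ _ W w-child→z-child ⟩
      old w + old z                                         ∎
      where open ≤-Reasoning
    new-other : ∀ v → v ≢ z → v ≢ w → new v ≤ old v
    new-other v v≢z v≢w =
      ≤-reflexive (cong₂ (λ c s → contribution c s W) (isChild-other v≢z) (size-other v≢z v≢w))

proposition4 : ∀ {n : ℕ} (H : ℕ) → 0 < H →
    (t : RawTree n) → IsTree t →
    (x : Fin n) → Basket t H x → ViolatesUnion t x →
    (z w : Fin n) → DistinctSiblings t z w →
    Light t H z → Light t H w →
    size t z + size t w ≤ H →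
    ViolatesUnion (push t z w) x
proposition4 H _ t tree x (h , h-child , h-heavy) (y , y-child , y-violates)
             z w (z≢w , z≢r , w≢r , pz≡pw) z-light w-light _ =
  violation-from-gap t′ x (size t y) gap large-child
  where
  open Push t (Ancestry.isTree→rooted t tree) z w z≢w z≢r w≢r pz≡pw
  -- x ≠ w and h ∉ {z, w}, as w and z are light but h is heavy and size h ≤ size x
  x≢w : x ≢ w
  x≢w refl = <⇒≱ h-heavy (≤-trans (child-size-≤ t h-child) w-light)
  h≢z : h ≢ z
  h≢z refl = <⇒≱ h-heavy z-light
  h≢w : h ≢ w
  h≢w refl = <⇒≱ h-heavy w-light
  gap : sumsize t′ x (size t y ∸ 1) < size t y ∸ 1
  gap = ≤-<-trans (sumsize-≤ x≢w (size t y ∸ 1)) y-violates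
  -- h is large enough to replace y when y is one of the light nodes z, w
  via-h : size t y ≤ H → size t y ≤ size t′ h
  via-h y≤H = ≤-trans y≤H (≤-trans (<⇒≤ h-heavy) (≤-reflexive (sym (size-other h≢z h≢w))))
  large-child : ∃ λ c → Child t′ x c × size t y ≤ size t′ c
  large-child with y ≟ z | y ≟ w
  ... | no y≢z | no y≢w = y , child-kept y≢z y-child , ≤-reflexive (sym (size-other y≢z y≢w))
  ... | yes refl | _    = h , child-kept h≢z h-child , via-h z-light
  ... | no _  | yes refl = h , child-kept h≢z h-child , via-h w-light
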